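{- Let $G$ be a graph, $r,k\in\mathbb{N}$, and $\mathcal{S}\subseteq V(G)$ a stable set bundle containing more than $r$ stable set classes. Let $G'$ be the graph obtained from $G$ by deleting all but $r$ of the stable set classes contained in $\mathcal{S}$. Then for all $t\le 2r$, $G$ is target-$t$ $k$-equidominating if and only if $G'$ is target-$t$ $k$-equidominating.
   Context: All graphs are finite, simple and undirected; $\mathbb{N}=\{1,2,\dots\}$. An mds is an inclusion-minimal set $D\subseteq V$ such that every vertex is in $D$ or adjacent to a vertex of $D$. An equidominating structure of $G$ is a pair $(w,t)$ with $t\in\mathbb{N}$, $w\colon V\to\mathbb{N}$, such that for all $D\subseteq V$: $D$ is an mds iff $\sum_{v\in D}w(v)=t$. $G$ is target-$t$ $k$-equidominating if it has an equidominating structure $(w,t)$ with $w\colon V\to\{1,\dots,k\}$. Two vertices $v,w$ are twins if $N(v)\setminus\{w\}=N(w)\setminus\{v\}$; a stable set class is an equivalence class of the twin relation with at least two pairwise non-adjacent elements. For $n\ge2$, $K_{2n}-ne$ is the complete graph on $2n$ vertices minus $n$ pairwise disjoint edges. A stable set bundle is an inclusion-maximal set $\mathcal{S}\subseteq V$ such that $G[\mathcal{S}]\cong K_{2n}-ne$ for some $n\ge2$ and every vertex of $\mathcal{S}$ is adjacent to the same vertices of $V\setminus\mathcal{S}$; it is the disjoint union of $n$ stable set classes of size two (the pairs of non-adjacent vertices). -}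

module Defs where

open import Data.Nat using (ℕ; zero; suc; _+_; _≤_; _*_)
open import Data.Bool using (Bool; true; false; if_then_else_)
open import Data.Fin using (Fin; zero; suc)
open import Function.Definitions using (Injective)
open import Data.Fin.Subset using (Subset; _∈_; _∉_; _⊆_)
open import Data.Vec using (Vec; []; _∷_; lookup)
open import Data.Product using (Σ; ∃; _×_; _,_; proj₁)
open import Data.Sum using (_⊎_)
open import Data.Unit using (⊤)
open import Relation.Nullary using (¬_)
open import Relation.Binary.PropositionalEquality using (_≡_; _≢_)
open import Function.Bundles using (_⇔_)

record Graph (N : ℕ) : Set where
  field
    adj     : Fin N → Fin N → Bool
    adj-sym : ∀ u v → adj u v ≡ adj v u
    adj-irr : ∀ v → adj v v ≡ false

open Graph public

Adj : ∀ {N} → Graph N → Fin N → Fin N → Set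
Adj G u v = adj G u v ≡ true

-- A vertex set U ⊆ V given as a predicate; G[U] is the induced subgraph.
VSet : ℕ → Set₁
VSet N = Fin N → Set

AllV : ∀ {N} → VSet N
AllV _ = ⊤

_⊆ᵥ_ : ∀ {N} → Subset N → VSet N → Set
D ⊆ᵥ U = ∀ v → v ∈ D → U v

Dominates : ∀ {N} → Graph N → VSet N → Subset N → Set
Dominates G U D = ∀ v → U v → v ∈ D ⊎ (∃ λ u → u ∈ D × Adj G u v)

MDS : ∀ {N} → Graph N → VSet N → Subset N → Set
MDS G U D = D ⊆ᵥ U × Dominates G U D
  × (∀ D' → D' ⊆ D → Dominates G U D' → D' ≡ D)

wsum : ∀ {N} → (Fin N → ℕ) → Subset N → ℕ
wsum {zero}  w []      = 0
wsum {suc N} w (b ∷ D) = (if b then w zero else 0) + wsum (λ i → w (suc i)) D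

TargetEquidominating : ∀ {N} → Graph N → VSet N → ℕ → ℕ → Set
TargetEquidominating {N} G U k t =
  1 ≤ t ×
  Σ (Fin N → ℕ) λ w →
    (∀ v → U v → 1 ≤ w v × w v ≤ k) ×
    (∀ D → D ⊆ᵥ U → (MDS G U D ⇔ wsum w D ≡ t))

Twins : ∀ {N} → Graph N → Fin N → Fin N → Set
Twins G v w = ∀ x → (Adj G v x × x ≢ w) ⇔ (Adj G w x × x ≢ v)

TwinClass : ∀ {N} → Graph N → Subset N → Set
TwinClass G C = ∃ λ v → ∀ x → (x ∈ C ⇔ Twins G v x)

StableSetClass : ∀ {N} → Graph N → Subset N → Set
StableSetClass G C = TwinClass G C ×
  ∃ λ a → ∃ λ b → a ∈ C × b ∈ C × a ≢ b × ¬ Adj G a b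

-- G[S] ≅ K_{2n} - ne, with K_{2n} - ne on vertex set Fin n × Fin 2,
-- where (i,x) ~ (j,y) iff i ≢ j.
InducesK2n-ne : ∀ {N} → Graph N → Subset N → ℕ → Set
InducesK2n-ne {N} G S n = Σ (Fin n × Fin 2 → Fin N) λ f →
  Injective _≡_ _≡_ f ×
  (∀ v → v ∈ S ⇔ (∃ λ p → f p ≡ v)) ×
  (∀ p q → Adj G (f p) (f q) ⇔ (proj₁ p ≢ proj₁ q))

HomogeneousOutside : ∀ {N} → Graph N → Subset N → Set
HomogeneousOutside G S = ∀ u v x → u ∈ S → v ∈ S → x ∉ S → adj G u x ≡ adj G v x

BundleCandidate : ∀ {N} → Graph N → Subset N → Set
BundleCandidate G S = (∃ λ n → 2 ≤ n × InducesK2n-ne G S n) × HomogeneousOutside G S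

StableSetBundle : ∀ {N} → Graph N → Subset N → Set
StableSetBundle G S = BundleCandidate G S × (∀ S' → S ⊆ S' → BundleCandidate G S' → S' ≡ S)

DistinctClassesIn : ∀ {N m} → Graph N → Subset N → Vec (Subset N) m → Set
DistinctClassesIn G S cs =
  (∀ i → StableSetClass G (lookup cs i) × lookup cs i ⊆ S) ×
  (∀ i j → i ≢ j → lookup cs i ≢ lookup cs j)

Remaining : ∀ {N m} → Graph N → Subset N → Vec (Subset N) m → VSet N
Remaining G S kept v = ¬ (∃ λ C → StableSetClass G C × C ⊆ S × v ∈ C
                                   × (∀ i → lookup kept i ≢ C))

module Submission where

-- Only two features of a bundle matter: G[S] is a cocktail-party graph (each
-- vertex of S has exactly one non-neighbour in S besides itself, its mate) and S
-- is a module (all of S has the same neighbours outside S).  For such an S,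
-- whether D is a (minimal) dominating set depends only on the part of D outside
-- S and on the number of vertices of D inside S (mds-similar); an mds has at
-- most two vertices in S.  The stable set classes inside S are the mate pairs.
--
-- Restricting: an mds of G' made of remaining vertices is an mds of G and
-- conversely, since every deleted vertex is dominated through a kept one.
-- Extending: in G' all kept vertices must carry the same weight c (compare the
-- mds obtained from one fixed mds by exchanging its two vertices in S for any two
-- kept vertices).  Giving every vertex of S weight c, each D with at most 2r
-- vertices in S is matched, with equal weight and minimality, by a set of
-- remaining vertices; heavier sets are neither mds nor of weight t ≤ 2r.

open import Defs
open import Data.Nat using (ℕ; zero; suc; _+_; _*_; _≤_; _<_; z≤n; s≤s; s≤s⁻¹; _≤?_)
open import Data.Nat.Properties
  using ( *-zeroʳ; *-suc; *-identityˡ; *-monoʳ-≤; +-assoc; +-comm; +-identityʳ; +-mono-≤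
        ; +-cancelˡ-≡; +-cancelʳ-≡; ≤-trans; <⇒≢; ≰⇒>; m≤m+n; m≤n+m; suc-injective
        ; module ≤-Reasoning )
open import Data.Nat.Tactic.RingSolver using (solve-∀)
open import Data.Bool using (true; false; if_then_else_) renaming (_≟_ to _≟ᵇ_)
open import Data.Fin using (Fin; zero; suc; _≟_)
open import Data.Fin.Properties using (any?) renaming (suc-injective to fin-suc-injective)
open import Data.Fin.Subset
open import Data.Fin.Subset.Properties
open import Data.Vec using (Vec; []; _∷_; here; there; lookup)
open import Data.List using (List; []; _∷_; allFin)
import Data.List.Membership.Propositional as List
open import Data.List.Membership.Propositional.Properties using (∈-allFin)
open import Data.List.Relation.Unary.Any using (here; there)
open import Data.Product using (Σ; ∃; _×_; _,_; proj₁; proj₂)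
open import Data.Sum using (_⊎_; inj₁; inj₂)
open import Function using (_∘_)
open import Function.Bundles using (_⇔_; mk⇔; Equivalence)
open import Function.Construct.Composition using (_⇔-∘_)
open import Function.Construct.Symmetry using (⇔-sym)
open import Relation.Nullary using (¬_; Dec; yes; no; does; contradiction; _×-dec_; _⊎-dec_)
open import Relation.Binary.PropositionalEquality

open Equivalence using (to; from)

forced-one : ∀ {a b} → a + b ≤ 2 → 1 ≤ a → 1 ≤ b → a ≡ 1
forced-one {suc zero}    _                         _ _ = refl
forced-one {suc (suc a)} {suc b} (s≤s (s≤s a+b≤0)) _ _ with ≤-trans (m≤n+m (suc b) a) a+b≤0
... | ()

m≤c*m : ∀ {c} m → 1 ≤ c → m ≤ c * m
m≤c*m {suc c} m _ = m≤m+n m (c * m)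

small-or-second : ∀ {r t} → t ≤ 2 * suc r → t ≤ 2 ⊎ Σ (Fin (suc r)) (λ j → j ≢ zero)
small-or-second {zero}  t≤2 = inj₁ t≤2
small-or-second {suc r} _   = inj₂ (suc zero , λ ())

Disjoint : ∀ {N} → Subset N → Subset N → Set
Disjoint A B = ∀ {v} → v ∈ A → v ∉ B

∈-remove⇒≢ : ∀ {N} {p : Subset N} {x y : Fin N} → y ∈ p - x → y ≢ x
∈-remove⇒≢ {p = b ∷ p} {zero}  {zero}  ()
∈-remove⇒≢ {p = b ∷ p} {suc x} {suc y} (there m) refl = ∈-remove⇒≢ {p = p} m refl
∈-remove⇒≢ {p = b ∷ p} {zero}  {suc y} _ ()
∈-remove⇒≢ {p = b ∷ p} {suc x} {zero}  _ ()

∩-remove : ∀ {N} (D P : Subset N) (x : Fin N) → (D - x) ∩ P ≡ (D ∩ P) - x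
∩-remove D P x = ⊆-antisym into onto
  where
  into : (D - x) ∩ P ⊆ (D ∩ P) - x
  into m with x∈p∩q⁻ (D - x) P m
  ... | yD-x , yP =
    x∈p∧x≢y⇒x∈p-y (x∈p∩q⁺ (p─q⊆p D ⁅ x ⁆ yD-x , yP)) (∈-remove⇒≢ yD-x)
  onto : (D ∩ P) - x ⊆ (D - x) ∩ P
  onto m with x∈p∩q⁻ D P (p─q⊆p (D ∩ P) ⁅ x ⁆ m)
  ... | yD , yP = x∈p∩q⁺ (x∈p∧x≢y⇒x∈p-y yD (∈-remove⇒≢ m) , yP)

remove-∉ : ∀ {N} {A : Subset N} {x : Fin N} → x ∉ A → A - x ≡ A
remove-∉ {A = A} {x} x∉A =
  ⊆-antisym (p─q⊆p A ⁅ x ⁆) (λ yA → x∈p∧x≢y⇒x∈p-y yA (λ { refl → x∉A yA }))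

pair : ∀ {N} → Fin N → Fin N → Subset N
pair x y = ⁅ x ⁆ ∪ ⁅ y ⁆

∈-pair⁻ : ∀ {N} {x y v : Fin N} → v ∈ pair x y → v ≡ x ⊎ v ≡ y
∈-pair⁻ {x = x} {y} m with x∈p∪q⁻ ⁅ x ⁆ ⁅ y ⁆ m
... | inj₁ h = inj₁ (x∈⁅y⁆⇒x≡y x h)
... | inj₂ h = inj₂ (x∈⁅y⁆⇒x≡y y h)

x∈pair : ∀ {N} (x y : Fin N) → x ∈ pair x y
x∈pair x y = x∈p∪q⁺ (inj₁ (x∈⁅x⁆ x))

y∈pair : ∀ {N} (x y : Fin N) → y ∈ pair x y
y∈pair x y = x∈p∪q⁺ (inj₂ (x∈⁅x⁆ y))

pair⊆ : ∀ {N} {x y : Fin N} {S : Subset N} → x ∈ S → y ∈ S → pair x y ⊆ S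
pair⊆ xS yS m with ∈-pair⁻ m
... | inj₁ refl = xS
... | inj₂ refl = yS

wsum-cong : ∀ {N} (w w' : Fin N → ℕ) (D : Subset N) →
            (∀ {v} → v ∈ D → w v ≡ w' v) → wsum w D ≡ wsum w' D
wsum-cong {zero}  w w' []          eq = refl
wsum-cong {suc N} w w' (true ∷ D)  eq =
  cong₂ _+_ (eq here) (wsum-cong _ _ D (λ m → eq (there m)))
wsum-cong {suc N} w w' (false ∷ D) eq = wsum-cong _ _ D (λ m → eq (there m))

wsum-const : ∀ {N} (w : Fin N → ℕ) (c : ℕ) (D : Subset N) →
             (∀ {v} → v ∈ D → w v ≡ c) → wsum w D ≡ c * ∣ D ∣
wsum-const {zero}  w c []          eq = sym (*-zeroʳ c)
wsum-const {suc N} w c (true ∷ D)  eq =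
  trans (cong₂ _+_ (eq here) (wsum-const _ c D (λ m → eq (there m)))) (sym (*-suc c ∣ D ∣))
wsum-const {suc N} w c (false ∷ D) eq = wsum-const _ c D (λ m → eq (there m))

wsum-∪ : ∀ {N} (w : Fin N → ℕ) (A B : Subset N) → Disjoint A B →
         wsum w (A ∪ B) ≡ wsum w A + wsum w B
wsum-∪ {zero}  w []          []          dj = refl
wsum-∪ {suc N} w (true ∷ A)  (true ∷ B)  dj = contradiction here (dj here)
wsum-∪ {suc N} w (true ∷ A)  (false ∷ B) dj =
  trans (cong (w zero +_) (wsum-∪ _ A B (λ a b → dj (there a) (there b))))
        (sym (+-assoc (w zero) _ _))
wsum-∪ {suc N} w (false ∷ A) (true ∷ B)  dj =
  trans (cong (w zero +_) (wsum-∪ w' A B (λ a b → dj (there a) (there b))))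
        (left-comm (w zero) (wsum w' A) (wsum w' B))
  where
  w' : Fin N → ℕ
  w' i = w (suc i)
  left-comm : ∀ x a b → x + (a + b) ≡ a + (x + b)
  left-comm = solve-∀
wsum-∪ {suc N} w (false ∷ A) (false ∷ B) dj = wsum-∪ _ A B (λ a b → dj (there a) (there b))

wsum-⊥ : ∀ {N} (w : Fin N → ℕ) → wsum w ⊥ ≡ 0
wsum-⊥ {zero}  w = refl
wsum-⊥ {suc N} w = wsum-⊥ (λ i → w (suc i))

wsum-⁅⁆ : ∀ {N} (w : Fin N → ℕ) (x : Fin N) → wsum w ⁅ x ⁆ ≡ w x
wsum-⁅⁆ {suc N} w zero    =
  trans (cong (w zero +_) (wsum-⊥ (λ i → w (suc i)))) (+-identityʳ (w zero))
wsum-⁅⁆ {suc N} w (suc x) = wsum-⁅⁆ (λ i → w (suc i)) x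

wsum-pair : ∀ {N} (w : Fin N → ℕ) {x y : Fin N} → x ≢ y → wsum w (pair x y) ≡ w x + w y
wsum-pair w {x} {y} x≢y =
  trans (wsum-∪ w ⁅ x ⁆ ⁅ y ⁆ apart) (cong₂ _+_ (wsum-⁅⁆ w x) (wsum-⁅⁆ w y))
  where
  apart : Disjoint ⁅ x ⁆ ⁅ y ⁆
  apart mx my = x≢y (trans (sym (x∈⁅y⁆⇒x≡y x mx)) (x∈⁅y⁆⇒x≡y y my))

split-by : ∀ {N} (D P : Subset N) → D ≡ (D ∩ P) ∪ (D ∩ ∁ P)
split-by D P = begin
  D                     ≡⟨ sym (∩-identityʳ D) ⟩
  D ∩ ⊤                 ≡⟨ cong (D ∩_) (sym (p∪∁p≡⊤ P)) ⟩
  D ∩ (P ∪ ∁ P)         ≡⟨ ∩-distribˡ-∪ D P (∁ P) ⟩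
  (D ∩ P) ∪ (D ∩ ∁ P)   ∎
  where open ≡-Reasoning

wsum-split : ∀ {N} (w : Fin N → ℕ) (D P : Subset N) →
             wsum w D ≡ wsum w (D ∩ P) + wsum w (D ∩ ∁ P)
wsum-split w D P =
  trans (cong (wsum w) (split-by D P)) (wsum-∪ w (D ∩ P) (D ∩ ∁ P) apart)
  where
  apart : Disjoint (D ∩ P) (D ∩ ∁ P)
  apart a b = x∈∁p⇒x∉p (proj₂ (x∈p∩q⁻ D (∁ P) b)) (proj₂ (x∈p∩q⁻ D P a))

card-as-wsum : ∀ {N} (D : Subset N) → ∣ D ∣ ≡ wsum (λ _ → 1) D
card-as-wsum D = trans (sym (*-identityˡ ∣ D ∣)) (sym (wsum-const _ 1 D (λ _ → refl)))

card-∪ : ∀ {N} (A B : Subset N) → Disjoint A B → ∣ A ∪ B ∣ ≡ ∣ A ∣ + ∣ B ∣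
card-∪ A B dj = begin
  ∣ A ∪ B ∣                             ≡⟨ card-as-wsum (A ∪ B) ⟩
  wsum (λ _ → 1) (A ∪ B)                ≡⟨ wsum-∪ _ A B dj ⟩
  wsum (λ _ → 1) A + wsum (λ _ → 1) B   ≡⟨ sym (cong₂ _+_ (card-as-wsum A) (card-as-wsum B)) ⟩
  ∣ A ∣ + ∣ B ∣                         ∎
  where open ≡-Reasoning

card-pair : ∀ {N} {x y : Fin N} → x ≢ y → ∣ pair x y ∣ ≡ 2
card-pair {x = x} {y} x≢y = trans (card-as-wsum (pair x y)) (wsum-pair _ x≢y)

card-remove : ∀ {N} {p : Subset N} {x : Fin N} → x ∈ p → ∣ p ∣ ≡ suc ∣ p - x ∣
card-remove {p = true ∷ p}  {zero}  here      = cong (suc ∘ ∣_∣) (sym (p─⊥≡p p))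
card-remove {p = true ∷ p}  {suc x} (there m) = cong suc (card-remove m)
card-remove {p = false ∷ p} {suc x} (there m) = card-remove m

card≥1 : ∀ {N} {p : Subset N} {x : Fin N} → x ∈ p → 1 ≤ ∣ p ∣
card≥1 xp rewrite card-remove xp = s≤s z≤n

card≥2 : ∀ {N} {p : Subset N} {x y : Fin N} → x ∈ p → y ∈ p → x ≢ y → 2 ≤ ∣ p ∣
card≥2 xp yp x≢y rewrite card-remove xp = s≤s (card≥1 (x∈p∧x≢y⇒x∈p-y yp (x≢y ∘ sym)))

element-of : ∀ {N} (p : Subset N) → 1 ≤ ∣ p ∣ → Nonempty p
element-of {N} p 1≤∣p∣ with nonempty? p
... | yes ne = ne
... | no ¬ne = contradiction (subst (λ q → 1 ≤ ∣ q ∣) (Empty-unique ¬ne) 1≤∣p∣)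
                             (λ 1≤∣⊥∣ → <⇒≢ 1≤∣⊥∣ (sym (∣⊥∣≡0 N)))

distinct-pair-of : ∀ {N} (p : Subset N) → 2 ≤ ∣ p ∣ →
                   ∃ λ x → ∃ λ y → x ∈ p × y ∈ p × x ≢ y
distinct-pair-of p 2≤∣p∣ with element-of p (≤-trans (s≤s z≤n) 2≤∣p∣)
... | x , xp with element-of (p - x) (s≤s⁻¹ (subst (2 ≤_) (card-remove xp) 2≤∣p∣))
... | y , yp = x , y , xp , p─q⊆p p ⁅ x ⁆ yp , ∈-remove⇒≢ yp ∘ sym

subset-of-size : ∀ {N} (p : Subset N) (m : ℕ) → m ≤ ∣ p ∣ → ∃ λ F → F ⊆ p × ∣ F ∣ ≡ m
subset-of-size {N} p zero _ = ⊥ , (λ m → contradiction m ∉⊥) , ∣⊥∣≡0 N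
subset-of-size (true ∷ p) (suc m) (s≤s m≤∣p∣) with subset-of-size p m m≤∣p∣
... | F , F⊆p , ∣F∣≡m = true ∷ F , keep , cong suc ∣F∣≡m
  where
  keep : true ∷ F ⊆ true ∷ p
  keep here      = here
  keep (there x) = there (F⊆p x)
subset-of-size (false ∷ p) (suc m) m<∣p∣ with subset-of-size p (suc m) m<∣p∣
... | F , F⊆p , ∣F∣≡m = false ∷ F , (λ { (there x) → there (F⊆p x) }) , ∣F∣≡m

⋃ᵥ : ∀ {N m} → Vec (Subset N) m → Subset N
⋃ᵥ []       = ⊥
⋃ᵥ (C ∷ Cs) = C ∪ ⋃ᵥ Cs

∈-⋃ᵥ⁺ : ∀ {N m} (Cs : Vec (Subset N) m) {x} j → x ∈ lookup Cs j → x ∈ ⋃ᵥ Cs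
∈-⋃ᵥ⁺ (C ∷ Cs) zero    m = x∈p∪q⁺ (inj₁ m)
∈-⋃ᵥ⁺ (C ∷ Cs) (suc j) m = x∈p∪q⁺ (inj₂ (∈-⋃ᵥ⁺ Cs j m))

∈-⋃ᵥ⁻ : ∀ {N m} (Cs : Vec (Subset N) m) {x} → x ∈ ⋃ᵥ Cs → ∃ λ j → x ∈ lookup Cs j
∈-⋃ᵥ⁻ []       m = contradiction m ∉⊥
∈-⋃ᵥ⁻ (C ∷ Cs) m with x∈p∪q⁻ C (⋃ᵥ Cs) m
... | inj₁ mC = zero , mC
... | inj₂ mU with ∈-⋃ᵥ⁻ Cs mU
... | j , mj = suc j , mj

card-⋃ᵥ : ∀ {N m} (Cs : Vec (Subset N) m) → (∀ j → 2 ≤ ∣ lookup Cs j ∣) →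
          (∀ i j → i ≢ j → Disjoint (lookup Cs i) (lookup Cs j)) → 2 * m ≤ ∣ ⋃ᵥ Cs ∣
card-⋃ᵥ []               _     _  = z≤n
card-⋃ᵥ {m = suc m} (C ∷ Cs) large dj = begin
  2 * suc m            ≡⟨ *-suc 2 m ⟩
  2 + 2 * m            ≤⟨ +-mono-≤ (large zero) (card-⋃ᵥ Cs (large ∘ suc) dj-tail) ⟩
  ∣ C ∣ + ∣ ⋃ᵥ Cs ∣    ≡⟨ sym (card-∪ C (⋃ᵥ Cs) C-apart) ⟩
  ∣ C ∪ ⋃ᵥ Cs ∣        ∎
  where
  open ≤-Reasoning
  dj-tail : ∀ i j → i ≢ j → Disjoint (lookup Cs i) (lookup Cs j)
  dj-tail i j i≢j = dj (suc i) (suc j) (i≢j ∘ fin-suc-injective)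
  C-apart : Disjoint C (⋃ᵥ Cs)
  C-apart xC xU with ∈-⋃ᵥ⁻ Cs xU
  ... | j , xj = dj zero (suc j) (λ ()) xC xj

Adj? : ∀ {N} (G : Graph N) (u v : Fin N) → Dec (Adj G u v)
Adj? G u v = adj G u v ≟ᵇ true

Adj-sym : ∀ {N} (G : Graph N) {u v : Fin N} → Adj G u v → Adj G v u
Adj-sym G {u} {v} a = trans (adj-sym G v u) a

Adj-irr : ∀ {N} (G : Graph N) {u : Fin N} → ¬ Adj G u u
Adj-irr G {u} a with trans (sym (adj-irr G u)) a
... | ()

DominatedBy : ∀ {N} → Graph N → Subset N → Fin N → Set
DominatedBy G D v = v ∈ D ⊎ ∃ λ u → u ∈ D × Adj G u v

dominated? : ∀ {N} (G : Graph N) (D : Subset N) (v : Fin N) → Dec (DominatedBy G D v)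
dominated? G D v = v ∈? D ⊎-dec any? (λ u → u ∈? D ×-dec Adj? G u v)

dominated-mono : ∀ {N} (G : Graph N) {D E : Subset N} {v : Fin N} →
                 D ⊆ E → DominatedBy G D v → DominatedBy G E v
dominated-mono G D⊆E (inj₁ m)           = inj₁ (D⊆E m)
dominated-mono G D⊆E (inj₂ (u , m , a)) = inj₂ (u , D⊆E m , a)

mds-min : ∀ {N} (G : Graph N) (U : VSet N) {D : Subset N} → MDS G U D →
          ∀ {x} → x ∈ D → ¬ Dominates G U (D - x)
mds-min G U {D} (_ , _ , minimal) {x} xD dom =
  ∈-remove⇒≢ (subst (x ∈_) (sym (minimal (D - x) (p─q⊆p D ⁅ x ⁆) dom)) xD) refl

mds-intro : ∀ {N} (G : Graph N) (U : VSet N) {D : Subset N} → D ⊆ᵥ U → Dominates G U D →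
            (∀ {x} → x ∈ D → ¬ Dominates G U (D - x)) → MDS G U D
mds-intro G U {D} D⊆U dom single =
  D⊆U , dom , λ D' D'⊆D dom' → ⊆-antisym D'⊆D (all-needed D' D'⊆D dom')
  where
  all-needed : ∀ D' → D' ⊆ D → Dominates G U D' → D ⊆ D'
  all-needed D' D'⊆D dom' {x} xD with x ∈? D'
  ... | yes xD' = xD'
  ... | no  xD' = contradiction (λ v Uv → dominated-mono G D'⊆D-x (dom' v Uv)) (single xD)
    where
    D'⊆D-x : D' ⊆ D - x
    D'⊆D-x yD' = x∈p∧x≢y⇒x∈p-y (D'⊆D yD') (λ { refl → xD' yD' })

Independent : ∀ {N} → Graph N → Subset N → Set
Independent G I = ∀ {u v} → u ∈ I → v ∈ I → ¬ Adj G u v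

pair-independent : ∀ {N} (G : Graph N) {x y : Fin N} → ¬ Adj G x y → Independent G (pair x y)
pair-independent G ¬xy u∈ v∈ with ∈-pair⁻ u∈ | ∈-pair⁻ v∈
... | inj₁ refl | inj₁ refl = Adj-irr G
... | inj₂ refl | inj₂ refl = Adj-irr G
... | inj₁ refl | inj₂ refl = ¬xy
... | inj₂ refl | inj₁ refl = ¬xy ∘ Adj-sym G

independent-insert : ∀ {N} (G : Graph N) {I : Subset N} {v : Fin N} → Independent G I →
                     ¬ DominatedBy G I v → Independent G (I ∪ ⁅ v ⁆)
independent-insert G {I} {v} ind undom {x} {y} xI yI
  with x∈p∪q⁻ I ⁅ v ⁆ xI | x∈p∪q⁻ I ⁅ v ⁆ yI
... | inj₁ x∈I | inj₁ y∈I = ind x∈I y∈I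
... | inj₁ x∈I | inj₂ y∈v rewrite x∈⁅y⁆⇒x≡y v y∈v = λ a → undom (inj₂ (x , x∈I , a))
... | inj₂ x∈v | inj₁ y∈I rewrite x∈⁅y⁆⇒x≡y v x∈v = λ a → undom (inj₂ (y , y∈I , Adj-sym G a))
... | inj₂ x∈v | inj₂ y∈v rewrite x∈⁅y⁆⇒x≡y v x∈v | x∈⁅y⁆⇒x≡y v y∈v = Adj-irr G

extend-independent : ∀ {N} (G : Graph N) (l : List (Fin N)) (I : Subset N) → Independent G I →
  ∃ λ J → I ⊆ J × Independent G J × (∀ {v} → v List.∈ l → DominatedBy G J v)
extend-independent G []      I ind = I , (λ m → m) , ind , λ ()
extend-independent G (v ∷ l) I ind with dominated? G I v
... | yes domv with extend-independent G l I ind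
...   | J , I⊆J , indJ , domJ =
        J , I⊆J , indJ , λ { (here refl) → dominated-mono G I⊆J domv ; (there m) → domJ m }
extend-independent G (v ∷ l) I ind | no undom
  with extend-independent G l (I ∪ ⁅ v ⁆) (independent-insert G ind undom)
... | J , I∪v⊆J , indJ , domJ =
        J , I∪v⊆J ∘ x∈p∪q⁺ ∘ inj₁ , indJ
          , λ { (here refl) → inj₁ (I∪v⊆J (x∈p∪q⁺ (inj₂ (x∈⁅x⁆ v))))
              ; (there m)   → domJ m }

extend-to-mds : ∀ {N} (G : Graph N) (I : Subset N) → Independent G I →
                ∃ λ J → I ⊆ J × Independent G J × MDS G AllV J
extend-to-mds {N} G I ind with extend-independent G (allFin N) I ind
... | J , I⊆J , indJ , domJ = J , I⊆J , indJ , mds-intro G AllV (λ _ _ → _) dom single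
  where
  dom : Dominates G AllV J
  dom v _ = domJ (∈-allFin v)
  single : ∀ {x} → x ∈ J → ¬ Dominates G AllV (J - x)
  single {x} xJ dom' with dom' x _
  ... | inj₁ x∈J-x        = ∈-remove⇒≢ x∈J-x refl
  ... | inj₂ (u , uJ , a) = indJ (p─q⊆p J ⁅ x ⁆ uJ) xJ a

-- A base vertex records that S is non-empty.
record CocktailModule {N} (G : Graph N) (S : Subset N) : Set where
  field
    homogeneous : HomogeneousOutside G S
    base        : Fin N
    base∈S      : base ∈ S
    mate        : ∀ {u} → u ∈ S → ∃ λ v → v ∈ S × v ≢ u × ¬ Adj G u v
    mate-unique : ∀ {u v v'} → u ∈ S → v ∈ S → v' ∈ S → v ≢ u → v' ≢ u →
                  ¬ Adj G u v → ¬ Adj G u v' → v ≡ v'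

other-of-two : ∀ {x y z : Fin 2} → y ≢ x → z ≢ x → y ≡ z
other-of-two {zero}     {zero}     y≢x _ = contradiction refl y≢x
other-of-two {suc zero} {suc zero} y≢x _ = contradiction refl y≢x
other-of-two {zero}     {suc zero} {zero}     _ z≢x = contradiction refl z≢x
other-of-two {zero}     {suc zero} {suc zero} _ _   = refl
other-of-two {suc zero} {zero}     {zero}     _ _   = refl
other-of-two {suc zero} {zero}     {suc zero} _ z≢x = contradiction refl z≢x

flip : Fin 2 → Fin 2
flip zero       = suc zero
flip (suc zero) = zero

flip≢ : ∀ x → flip x ≢ x
flip≢ zero       ()
flip≢ (suc zero) ()

-- An induced copy of K_{2n} - ne with homogeneous outside neighbourhood is a
-- cocktail-party module: (i , x) and (j , y) are adjacent iff i ≢ j, so the mate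
-- of (i , x) is (i , flip x).
bundle-cocktail : ∀ {N} {G : Graph N} {S : Subset N} → BundleCandidate G S → CocktailModule G S
bundle-cocktail {N} {G} {S} ((suc n , _ , f , f-inj , f-onto , f-adj) , hom) = record
  { homogeneous = hom
  ; base        = f (zero , zero)
  ; base∈S      = from (f-onto _) (_ , refl)
  ; mate        = mate
  ; mate-unique = mate-unique
  }
  where
  same-row : ∀ {p q} → ¬ Adj G (f p) (f q) → proj₁ p ≡ proj₁ q
  same-row {p} {q} ¬a with proj₁ p ≟ proj₁ q
  ... | yes eq = eq
  ... | no  ne = contradiction (from (f-adj p q) ne) ¬a

  mate : ∀ {u} → u ∈ S → ∃ λ v → v ∈ S × v ≢ u × ¬ Adj G u v
  mate {u} uS with to (f-onto u) uS
  ... | (i , x) , refl = f (i , flip x) , from (f-onto _) (_ , refl)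
                       , (λ e → flip≢ x (cong proj₂ (f-inj e)))
                       , (λ a → to (f-adj (i , x) (i , flip x)) a refl)

  mate-unique : ∀ {u v v'} → u ∈ S → v ∈ S → v' ∈ S → v ≢ u → v' ≢ u →
                ¬ Adj G u v → ¬ Adj G u v' → v ≡ v'
  mate-unique {u} {v} {v'} uS vS v'S v≢u v'≢u ¬uv ¬uv'
    with to (f-onto u) uS | to (f-onto v) vS | to (f-onto v') v'S
  ... | (i , x) , refl | (j , y) , refl | (l , z) , refl
    with same-row {i , x} {j , y} ¬uv | same-row {i , x} {l , z} ¬uv'
  ... | refl | refl = cong in-row (other-of-two (v≢u ∘ cong in-row) (v'≢u ∘ cong in-row))
    where
    in-row : Fin 2 → Fin N
    in-row c = f (i , c)

module Cocktail {N} {G : Graph N} {S : Subset N} (cm : CocktailModule G S) where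
  open CocktailModule cm

  homogeneous-adj : ∀ {u u' x} → u ∈ S → u' ∈ S → x ∉ S → Adj G u x → Adj G u' x
  homogeneous-adj uS u'S x∉S a = trans (sym (homogeneous _ _ _ uS u'S x∉S)) a

  adjacent-to-one-of : ∀ {v s₁ s₂} → v ∈ S → s₁ ∈ S → s₂ ∈ S → s₁ ≢ s₂ → s₁ ≢ v → s₂ ≢ v →
                       Adj G v s₁ ⊎ Adj G v s₂
  adjacent-to-one-of {v} {s₁} {s₂} vS s₁S s₂S s₁≢s₂ s₁≢v s₂≢v with Adj? G v s₁ | Adj? G v s₂
  ... | yes a  | _      = inj₁ a
  ... | no  _  | yes a  = inj₂ a
  ... | no ¬a₁ | no ¬a₂ = contradiction (mate-unique vS s₁S s₂S s₁≢v s₂≢v ¬a₁ ¬a₂) s₁≢s₂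

  Mate : Fin N → Fin N → Set
  Mate u v = u ∈ S × v ∈ S × ¬ Adj G u v

  mate-refl : ∀ {u} → u ∈ S → Mate u u
  mate-refl uS = uS , uS , Adj-irr G

  mate-sym : ∀ {u v} → Mate u v → Mate v u
  mate-sym (uS , vS , ¬a) = vS , uS , ¬a ∘ Adj-sym G

  mate-trans : ∀ {u v w} → Mate u v → Mate v w → Mate u w
  mate-trans {u} {v} {w} (uS , vS , ¬uv) (_ , wS , ¬vw) with u ≟ v | w ≟ v
  ... | yes refl | _        = uS , wS , ¬vw
  ... | no  _    | yes refl = uS , wS , ¬uv
  ... | no u≢v   | no w≢v   with mate-unique vS uS wS u≢v w≢v (¬uv ∘ Adj-sym G) ¬vw
  ...   | refl = mate-refl uS

  -- Twins inside S are mates: if x and y were adjacent, the mate of x would be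
  -- adjacent to y but not to x.
  twin-mate : ∀ {x y} → x ∈ S → y ∈ S → Twins G x y → Mate x y
  twin-mate {x} {y} xS yS twins with y ≟ x | mate xS
  ... | yes refl | _ = mate-refl xS
  ... | no y≢x | x' , x'S , x'≢x , ¬xx' with x' ≟ y
  ...   | yes refl = xS , yS , ¬xx'
  ...   | no x'≢y with Adj? G x' y
  ...     | yes a = contradiction (proj₁ (from (twins x') (Adj-sym G a , x'≢x))) ¬xx'
  ...     | no ¬a = contradiction
    (mate-unique x'S xS yS (x'≢x ∘ sym) (x'≢y ∘ sym) (¬xx' ∘ Adj-sym G) ¬a) (y≢x ∘ sym)

  class-is-mate-class : ∀ {C} → StableSetClass G C → C ⊆ S → ∃ λ c → ∀ y → y ∈ C ⇔ Mate c y
  class-is-mate-class {C} ((c , rep) , a , b , aC , bC , a≢b , _) C⊆S =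
    c , λ y → mk⇔ (into y) (onto y)
    where
    cC : c ∈ C
    cC = from (rep c) (λ _ → mk⇔ (λ h → h) (λ h → h))
    cS : c ∈ S
    cS = C⊆S cC
    into : ∀ y → y ∈ C → Mate c y
    into y yC = twin-mate cS (C⊆S yC) (to (rep y) yC)
    other : ∃ λ e → e ∈ C × e ≢ c
    other with a ≟ c
    ... | yes refl = b , bC , a≢b ∘ sym
    ... | no a≢c   = a , aC , a≢c
    onto : ∀ y → Mate c y → y ∈ C
    onto y (_ , yS , ¬cy) with y ≟ c | other
    ... | yes refl | _ = cC
    ... | no y≢c | e , eC , e≢c with into e eC
    ...   | _ , eS , ¬ce = subst (_∈ C) (mate-unique cS eS yS e≢c y≢c ¬ce ¬cy) eC

  module _ {C} (sc : StableSetClass G C) (C⊆S : C ⊆ S) where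
    private
      c : Fin N
      c = proj₁ (class-is-mate-class sc C⊆S)
      mate-class : ∀ y → y ∈ C ⇔ Mate c y
      mate-class = proj₂ (class-is-mate-class sc C⊆S)

    class-mates : ∀ {x y} → x ∈ C → y ∈ C → Mate x y
    class-mates {x} {y} xC yC = mate-trans (mate-sym (to (mate-class x) xC)) (to (mate-class y) yC)

    class-closed : ∀ {x y} → x ∈ C → Mate x y → y ∈ C
    class-closed {x} {y} xC xy = from (mate-class y) (mate-trans (to (mate-class x) xC) xy)

  classes-meet⇒equal : ∀ {C C'} (sc : StableSetClass G C) (C⊆S : C ⊆ S)
                       (sc' : StableSetClass G C') (C'⊆S : C' ⊆ S) {x} → x ∈ C → x ∈ C' → C ≡ C'
  classes-meet⇒equal sc C⊆S sc' C'⊆S xC xC' =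
    ⊆-antisym (λ yC  → class-closed sc' C'⊆S xC' (class-mates sc C⊆S xC yC))
              (λ yC' → class-closed sc C⊆S xC (class-mates sc' C'⊆S xC' yC'))

  outer : Subset N → Subset N
  outer D = D ∩ ∁ S

  inner : Subset N → ℕ
  inner D = ∣ D ∩ S ∣

  outer⁺ : ∀ {D u} → u ∈ D → u ∉ S → u ∈ outer D
  outer⁺ uD u∉S = x∈p∩q⁺ (uD , x∉p⇒x∈∁p u∉S)

  outer⁻ : ∀ {D u} → u ∈ outer D → u ∈ D × u ∉ S
  outer⁻ {D} m with x∈p∩q⁻ D (∁ S) m
  ... | uD , u∈∁S = uD , x∈∁p⇒x∉p u∈∁S

  inner⁺ : ∀ {D u} → u ∈ D → u ∈ S → u ∈ D ∩ S
  inner⁺ uD uS = x∈p∩q⁺ (uD , uS)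

  two-dominate-S : ∀ {T v} → T ⊆ S → 2 ≤ ∣ T ∣ → v ∈ S → DominatedBy G T v
  two-dominate-S {T} {v} T⊆S 2≤∣T∣ vS with distinct-pair-of T 2≤∣T∣
  ... | s₁ , s₂ , s₁T , s₂T , s₁≢s₂ with v ≟ s₁ | v ≟ s₂
  ...   | yes refl | _        = inj₁ s₁T
  ...   | no  _    | yes refl = inj₁ s₂T
  ...   | no v≢s₁  | no v≢s₂
    with adjacent-to-one-of vS (T⊆S s₁T) (T⊆S s₂T) s₁≢s₂ (v≢s₁ ∘ sym) (v≢s₂ ∘ sym)
  ...     | inj₁ a = inj₂ (s₁ , s₁T , Adj-sym G a)
  ...     | inj₂ a = inj₂ (s₂ , s₂T , Adj-sym G a)

  one-misses-S : ∀ {T} → T ⊆ S → ¬ 2 ≤ ∣ T ∣ → ∃ λ z → z ∈ S × ¬ DominatedBy G T z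
  one-misses-S {T} T⊆S small with nonempty? T
  ... | no empty = base , base∈S , λ { (inj₁ m)           → empty (base , m)
                                     ; (inj₂ (u , m , _)) → empty (u , m) }
  ... | yes (s , sT) with mate (T⊆S sT)
  ...   | s' , s'S , s'≢s , ¬ss' = s' , s'S , undominated
    where
    undominated : ¬ DominatedBy G T s'
    undominated (inj₁ s'T) = small (card≥2 sT s'T (s'≢s ∘ sym))
    undominated (inj₂ (u , uT , a)) with u ≟ s
    ... | yes refl = ¬ss' a
    ... | no  u≢s  = small (card≥2 uT sT u≢s)

  -- By homogeneity, adjacency to S is adjacency to the base vertex.
  Profile : Subset N → ℕ → Set
  Profile O m = (∀ v → v ∉ S → DominatedBy G O v ⊎ (1 ≤ m × Adj G base v))
              × ((∃ λ u → u ∈ O × Adj G base u) ⊎ 2 ≤ m)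

  dominates⇒profile : ∀ D → Dominates G AllV D → Profile (outer D) (inner D)
  dominates⇒profile D dom = off-S , on-S
    where
    off-S : ∀ v → v ∉ S → DominatedBy G (outer D) v ⊎ (1 ≤ inner D × Adj G base v)
    off-S v v∉S with dom v _
    ... | inj₁ vD = inj₁ (inj₁ (outer⁺ vD v∉S))
    ... | inj₂ (u , uD , a) with u ∈? S
    ...   | yes uS  = inj₂ (card≥1 (inner⁺ uD uS) , homogeneous-adj uS base∈S v∉S a)
    ...   | no  u∉S = inj₁ (inj₂ (u , outer⁺ uD u∉S , a))
    on-S : (∃ λ u → u ∈ outer D × Adj G base u) ⊎ 2 ≤ inner D
    on-S with 2 ≤? inner D
    ... | yes large = inj₂ large
    ... | no  small with one-misses-S (p∩q⊆q D S) small
    ...   | z , zS , undom with dom z _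
    ...     | inj₁ zD = contradiction (inj₁ (inner⁺ zD zS)) undom
    ...     | inj₂ (u , uD , a) with u ∈? S
    ...       | yes uS  = contradiction (inj₂ (u , inner⁺ uD uS , a)) undom
    ...       | no  u∉S = inj₁ (u , outer⁺ uD u∉S , homogeneous-adj zS base∈S u∉S (Adj-sym G a))

  profile⇒dominates : ∀ D → Profile (outer D) (inner D) → Dominates G AllV D
  profile⇒dominates D (off-S , on-S) v _ with v ∈? S
  ... | no v∉S with off-S v v∉S
  ...   | inj₁ dom = dominated-mono G (p∩q⊆p D (∁ S)) dom
  ...   | inj₂ (1≤m , a) with element-of (D ∩ S) 1≤m
  ...     | s , sDS = inj₂ (s , p∩q⊆p D S sDS , homogeneous-adj base∈S (p∩q⊆q D S sDS) v∉S a)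
  profile⇒dominates D (off-S , on-S) v _ | yes vS with on-S
  ... | inj₁ (u , uO , a) with outer⁻ uO
  ...   | uD , u∉S = inj₂ (u , uD , Adj-sym G (homogeneous-adj base∈S vS u∉S a))
  profile⇒dominates D (off-S , on-S) v _ | yes vS | inj₂ large =
    dominated-mono G (p∩q⊆p D S) (two-dominate-S (p∩q⊆q D S) large vS)

  profile-saturate : ∀ {O m m'} → 2 ≤ m' → Profile O m → Profile O m'
  profile-saturate {O} {m} {m'} 2≤m' (off-S , _) = off-S' , inj₂ 2≤m'
    where
    off-S' : ∀ v → v ∉ S → DominatedBy G O v ⊎ (1 ≤ m' × Adj G base v)
    off-S' v v∉S with off-S v v∉S
    ... | inj₁ dom     = inj₁ dom
    ... | inj₂ (_ , a) = inj₂ (≤-trans (s≤s z≤n) 2≤m' , a)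

  Similar : Subset N → Subset N → Set
  Similar D E = outer D ≡ outer E × inner D ≡ inner E

  similar-sym : ∀ {D E} → Similar D E → Similar E D
  similar-sym (o , i) = sym o , sym i

  dominates-similar : ∀ {D E} → Similar D E → Dominates G AllV D → Dominates G AllV E
  dominates-similar {D} {E} (o , i) dom =
    profile⇒dominates E (subst₂ Profile o i (dominates⇒profile D dom))

  outer-remove-inside : ∀ D {x} → x ∈ S → outer (D - x) ≡ outer D
  outer-remove-inside D {x} xS =
    trans (∩-remove D (∁ S) x) (remove-∉ (λ m → proj₂ (outer⁻ m) xS))

  inner-remove-outside : ∀ D {x} → x ∉ S → inner (D - x) ≡ inner D
  inner-remove-outside D {x} x∉S =
    cong ∣_∣ (trans (∩-remove D S x) (remove-∉ (x∉S ∘ p∩q⊆q D S)))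

  inner-remove-inside : ∀ D {x} → x ∈ D → x ∈ S → inner D ≡ suc (inner (D - x))
  inner-remove-inside D {x} xD xS =
    trans (card-remove (inner⁺ xD xS)) (cong (suc ∘ ∣_∣) (sym (∩-remove D S x)))

  remove-similar-outside : ∀ {D E x} → Similar D E → x ∉ S → Similar (D - x) (E - x)
  remove-similar-outside {D} {E} {x} (o , i) x∉S =
    trans (∩-remove D (∁ S) x) (trans (cong (_- x) o) (sym (∩-remove E (∁ S) x))) ,
    trans (inner-remove-outside D x∉S) (trans i (sym (inner-remove-outside E x∉S)))

  remove-similar-inside : ∀ {D E x y} → Similar D E → x ∈ E → x ∈ S → y ∈ D → y ∈ S →
                          Similar (D - y) (E - x)
  remove-similar-inside {D} {E} {x} {y} (o , i) xE xS yD yS =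
    trans (outer-remove-inside D yS) (trans o (sym (outer-remove-inside E xS))) ,
    suc-injective (trans (sym (inner-remove-inside D yD yS)) (trans i (inner-remove-inside E xE xS)))

  remove-similar : ∀ {D E} → Similar D E → ∀ {x} → x ∈ E →
                   ∃ λ y → y ∈ D × Similar (D - y) (E - x)
  remove-similar {D} {E} sim@(o , i) {x} xE with x ∈? S
  ... | no x∉S = x , xD , remove-similar-outside sim x∉S
    where
    xD : x ∈ D
    xD = proj₁ (outer⁻ (subst (x ∈_) (sym o) (outer⁺ xE x∉S)))
  ... | yes xS
    with element-of (D ∩ S) (subst (1 ≤_) (sym (trans i (inner-remove-inside E xE xS))) (s≤s z≤n))
  ...   | y , yDS = y , yD , remove-similar-inside sim xE xS yD (p∩q⊆q D S yDS)
    where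
    yD : y ∈ D
    yD = p∩q⊆p D S yDS

  mds-similar : ∀ {D E} → Similar D E → MDS G AllV D → MDS G AllV E
  mds-similar {D} {E} sim mds@(_ , dom , _) =
    mds-intro G AllV (λ _ _ → _) (dominates-similar sim dom) single
    where
    single : ∀ {x} → x ∈ E → ¬ Dominates G AllV (E - x)
    single xE dom' with remove-similar sim xE
    ... | y , yD , sim' = mds-min G AllV mds yD (dominates-similar (similar-sym sim') dom')

  mds-similar⇔ : ∀ {D E} → Similar D E → MDS G AllV D ⇔ MDS G AllV E
  mds-similar⇔ sim = mk⇔ (mds-similar sim) (mds-similar (similar-sym sim))

  -- A minimal dominating set has at most two vertices in S: with three, any one
  -- of them could be dropped.
  mds-inner≤2 : ∀ {D} → MDS G AllV D → ¬ 3 ≤ inner D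
  mds-inner≤2 {D} mds@(_ , dom , _) 3≤m with element-of (D ∩ S) (≤-trans (s≤s z≤n) 3≤m)
  ... | x , xDS = mds-min G AllV mds xD (profile⇒dominates (D - x) profile)
    where
    xD : x ∈ D
    xD = p∩q⊆p D S xDS
    xS : x ∈ S
    xS = p∩q⊆q D S xDS
    profile : Profile (outer (D - x)) (inner (D - x))
    profile = subst (λ O → Profile O (inner (D - x))) (sym (outer-remove-inside D xS))
      (profile-saturate (s≤s⁻¹ (subst (3 ≤_) (inner-remove-inside D xD xS) 3≤m))
                        (dominates⇒profile D dom))

  replace : Subset N → Subset N → Subset N
  replace D F = outer D ∪ F

  replace-outer : ∀ D {F} → F ⊆ S → outer (replace D F) ≡ outer D
  replace-outer D {F} F⊆S = ⊆-antisym into (λ m → outer⁺ (p⊆p∪q F m) (proj₂ (outer⁻ m)))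
    where
    into : outer (replace D F) ⊆ outer D
    into m with outer⁻ m
    ... | m' , v∉S with x∈p∪q⁻ (outer D) F m'
    ...   | inj₁ vO = vO
    ...   | inj₂ vF = contradiction (F⊆S vF) v∉S

  replace-inner : ∀ D {F} → F ⊆ S → replace D F ∩ S ≡ F
  replace-inner D {F} F⊆S = ⊆-antisym into (λ m → inner⁺ (q⊆p∪q (outer D) F m) (F⊆S m))
    where
    into : replace D F ∩ S ⊆ F
    into m with x∈p∩q⁻ (replace D F) S m
    ... | m' , vS with x∈p∪q⁻ (outer D) F m'
    ...   | inj₁ vO = contradiction vS (proj₂ (outer⁻ vO))
    ...   | inj₂ vF = vF

  replace-similar : ∀ D {F} → F ⊆ S → ∣ F ∣ ≡ inner D → Similar D (replace D F)
  replace-similar D F⊆S ∣F∣ =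
    sym (replace-outer D F⊆S) , sym (trans (cong ∣_∣ (replace-inner D F⊆S)) ∣F∣)

  wsum-replace : ∀ (w : Fin N → ℕ) D {F} → F ⊆ S →
                 wsum w (replace D F) ≡ wsum w (outer D) + wsum w F
  wsum-replace w D {F} F⊆S = wsum-∪ w (outer D) F (λ vO vF → proj₂ (outer⁻ vO) (F⊆S vF))

  module Deletion {r} (kept : Vec (Subset N) (suc r)) (distinct : DistinctClassesIn G S kept) where

    U : VSet N
    U = Remaining G S kept

    Deleted : Fin N → Set
    Deleted v = ∃ λ C → StableSetClass G C × C ⊆ S × v ∈ C × (∀ i → lookup kept i ≢ C)

    kept-class : ∀ j → StableSetClass G (lookup kept j)
    kept-class j = proj₁ (proj₁ distinct j)

    kept⊆S : ∀ j → lookup kept j ⊆ S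
    kept⊆S j = proj₂ (proj₁ distinct j)

    kept-disjoint : ∀ i j → i ≢ j → Disjoint (lookup kept i) (lookup kept j)
    kept-disjoint i j i≢j xi xj = proj₂ distinct i j i≢j
      (classes-meet⇒equal (kept-class i) (kept⊆S i) (kept-class j) (kept⊆S j) xi xj)

    kept∈U : ∀ j {x} → x ∈ lookup kept j → U x
    kept∈U j xj (C , sc , C⊆S , xC , not-kept) =
      not-kept j (classes-meet⇒equal (kept-class j) (kept⊆S j) sc C⊆S xj xC)

    outside∈U : ∀ {x} → x ∉ S → U x
    outside∈U x∉S (C , _ , C⊆S , xC , _) = x∉S (C⊆S xC)

    first-pair : ∃ λ a → ∃ λ b → a ∈ lookup kept zero × b ∈ lookup kept zero
                               × a ≢ b × ¬ Adj G a b
    first-pair = proj₂ (kept-class zero)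

    p q : Fin N
    p = proj₁ first-pair
    q = proj₁ (proj₂ first-pair)

    p∈kept : p ∈ lookup kept zero
    p∈kept = proj₁ (proj₂ (proj₂ first-pair))

    q∈kept : q ∈ lookup kept zero
    q∈kept = proj₁ (proj₂ (proj₂ (proj₂ first-pair)))

    p≢q : p ≢ q
    p≢q = proj₁ (proj₂ (proj₂ (proj₂ (proj₂ first-pair))))

    ¬pq : ¬ Adj G p q
    ¬pq = proj₂ (proj₂ (proj₂ (proj₂ (proj₂ first-pair))))

    pS : p ∈ S
    pS = kept⊆S zero p∈kept

    qS : q ∈ S
    qS = kept⊆S zero q∈kept

    -- A remaining vertex u ∈ S is adjacent to every deleted vertex v, since a
    -- non-adjacent u would be a mate of v and hence deleted as well.
    S-vertex-dominates-deleted : ∀ {D u v} → D ⊆ᵥ U → Deleted v → u ∈ D → u ∈ S →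
                                 DominatedBy G D v
    S-vertex-dominates-deleted {D} {u} {v} D⊆U (C , sc , C⊆S , vC , not-kept) uD uS with Adj? G u v
    ... | yes a  = inj₂ (u , uD , a)
    ... | no ¬uv = contradiction (C , sc , (λ {x} → C⊆S {x}) , uC , not-kept) (D⊆U u uD)
      where
      uC : u ∈ C
      uC = class-closed sc C⊆S vC (C⊆S vC , uS , ¬uv ∘ Adj-sym G)

    -- Whatever dominates the kept vertex p (inside S, or outside S by
    -- homogeneity) also dominates every deleted vertex.
    deleted-dominated : ∀ {D v} → D ⊆ᵥ U → Deleted v → DominatedBy G D p → DominatedBy G D v
    deleted-dominated D⊆U del (inj₁ pD) = S-vertex-dominates-deleted D⊆U del pD pS
    deleted-dominated D⊆U del@(_ , _ , C⊆S , vC , _) (inj₂ (u , uD , a)) with u ∈? S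
    ... | yes uS  = S-vertex-dominates-deleted D⊆U del uD uS
    ... | no  u∉S = inj₂ (u , uD , Adj-sym G (homogeneous-adj pS (C⊆S vC) u∉S (Adj-sym G a)))

    dominates-remaining : ∀ {D} → D ⊆ᵥ U → Dominates G U D → Dominates G AllV D
    dominates-remaining {D} D⊆U dom v _ with dominated? G D v
    ... | yes domv = domv
    ... | no undom = contradiction (dom v remaining) undom
      where
      remaining : U v
      remaining del = undom (deleted-dominated D⊆U del (dom p (kept∈U zero p∈kept)))

    mds-remaining : ∀ D → D ⊆ᵥ U → MDS G U D ⇔ MDS G AllV D
    mds-remaining D D⊆U = mk⇔ in-G in-G'
      where
      in-G : MDS G U D → MDS G AllV D
      in-G mds@(_ , dom , _) = mds-intro G AllV (λ _ _ → _) (dominates-remaining D⊆U dom)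
                                 (λ xD dom' → mds-min G U mds xD (λ v _ → dom' v _))
      in-G' : MDS G AllV D → MDS G U D
      in-G' mds@(_ , dom , _) =
        mds-intro G U D⊆U (λ v _ → dom v _)
          (λ {x} xD dom' → mds-min G AllV mds xD (dominates-remaining (D-x⊆U x) dom'))
        where
        D-x⊆U : ∀ x → (D - x) ⊆ᵥ U
        D-x⊆U x v m = D⊆U v (p─q⊆p D ⁅ x ⁆ m)

    S' : Subset N
    S' = ⋃ᵥ kept

    S'⊆S : S' ⊆ S
    S'⊆S m with ∈-⋃ᵥ⁻ kept m
    ... | j , mj = kept⊆S j mj

    S'⊆U : ∀ {v} → v ∈ S' → U v
    S'⊆U m with ∈-⋃ᵥ⁻ kept m
    ... | j , mj = kept∈U j mj

    ∣S'∣ : 2 * suc r ≤ ∣ S' ∣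
    ∣S'∣ = card-⋃ᵥ kept two-each kept-disjoint
      where
      two-each : ∀ j → 2 ≤ ∣ lookup kept j ∣
      two-each j with kept-class j
      ... | _ , _ , _ , aC , bC , a≢b , _ = card≥2 aC bC a≢b

    p∈S' : p ∈ S'
    p∈S' = ∈-⋃ᵥ⁺ kept zero p∈kept

    q∈S' : q ∈ S'
    q∈S' = ∈-⋃ᵥ⁺ kept zero q∈kept

    another-kept : ∀ v → ∃ λ u → u ∈ S' × u ≢ v
    another-kept v with v ≟ p
    ... | yes refl = q , q∈S' , p≢q ∘ sym
    ... | no v≢p   = p , p∈S' , v≢p ∘ sym

    third-kept : ∀ j → j ≢ zero → ∀ {v} → v ≢ p → ∃ λ z → z ∈ S' × z ≢ v × z ≢ p
    third-kept j j≢0 {v} v≢p with v ≟ q | kept-class j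
    ... | no v≢q   | _ = q , q∈S' , v≢q ∘ sym , p≢q ∘ sym
    ... | yes refl | _ , a , _ , aC , _ = a , ∈-⋃ᵥ⁺ kept j aC
                                        , (λ { refl → kept-disjoint j zero j≢0 aC q∈kept })
                                        , (λ { refl → kept-disjoint j zero j≢0 aC p∈kept })

    replace⊆U : ∀ D {F} → F ⊆ S' → replace D F ⊆ᵥ U
    replace⊆U D {F} F⊆S' v m with x∈p∪q⁻ (outer D) F m
    ... | inj₁ vO = outside∈U (proj₂ (outer⁻ vO))
    ... | inj₂ vF = S'⊆U (F⊆S' vF)

    -- A maximal independent set I containing p and q is an mds of G meeting S in
    -- exactly {p , q}, as every other vertex of S is adjacent to p or to q.
    I-data : ∃ λ I → pair p q ⊆ I × Independent G I × MDS G AllV I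
    I-data = extend-to-mds G (pair p q) (pair-independent G ¬pq)

    I : Subset N
    I = proj₁ I-data

    I-mds : MDS G AllV I
    I-mds = proj₂ (proj₂ (proj₂ I-data))

    inner-I : inner I ≡ 2
    inner-I = trans (cong ∣_∣ (⊆-antisym only-pq pq⊆I∩S)) (card-pair p≢q)
      where
      pq⊆I : pair p q ⊆ I
      pq⊆I = proj₁ (proj₂ I-data)
      pq⊆I∩S : pair p q ⊆ I ∩ S
      pq⊆I∩S m = inner⁺ (pq⊆I m) (pair⊆ pS qS m)
      independent : Independent G I
      independent = proj₁ (proj₂ (proj₂ I-data))
      only-pq : I ∩ S ⊆ pair p q
      only-pq {s} m with x∈p∩q⁻ I S m
      ... | sI , sS with s ≟ p | s ≟ q
      ...   | yes refl | _        = x∈pair p q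
      ...   | no _     | yes refl = y∈pair p q
      ...   | no s≢p   | no s≢q with adjacent-to-one-of sS pS qS p≢q (s≢p ∘ sym) (s≢q ∘ sym)
      ...     | inj₁ a = contradiction a (independent sI (pq⊆I (x∈pair p q)))
      ...     | inj₂ a = contradiction a (independent sI (pq⊆I (y∈pair p q)))

    pair-mds : ∀ {x y} → x ≢ y → x ∈ S' → y ∈ S' → MDS G U (replace I (pair x y))
    pair-mds {x} {y} x≢y xS' yS' = from (mds-remaining _ (replace⊆U I (pair⊆ xS' yS')))
                                        (mds-similar similar I-mds)
      where
      similar : Similar I (replace I (pair x y))
      similar = replace-similar I (pair⊆ (S'⊆S xS') (S'⊆S yS'))
                                  (trans (card-pair x≢y) (sym inner-I))

    module Weights (w' : Fin N → ℕ) (t : ℕ)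
                   (equi : ∀ D → D ⊆ᵥ U → (MDS G U D ⇔ wsum w' D ≡ t)) where

      K : ℕ
      K = wsum w' (outer I)

      pair-weight : ∀ {x y} → x ≢ y → x ∈ S' → y ∈ S' → K + (w' x + w' y) ≡ t
      pair-weight {x} {y} x≢y xS' yS' = begin
        K + (w' x + w' y)               ≡⟨ cong (K +_) (sym (wsum-pair w' x≢y)) ⟩
        K + wsum w' (pair x y)          ≡⟨ sym (wsum-replace w' I (pair⊆ (S'⊆S xS') (S'⊆S yS'))) ⟩
        wsum w' (replace I (pair x y))  ≡⟨ to (equi _ E⊆U) (pair-mds x≢y xS' yS') ⟩
        t                               ∎
        where
        open ≡-Reasoning
        E⊆U : replace I (pair x y) ⊆ᵥ U
        E⊆U = replace⊆U I (pair⊆ xS' yS')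

      weights-one : t ≤ 2 → (∀ {v} → U v → 1 ≤ w' v) → ∀ {v} → v ∈ S' → w' v ≡ 1
      weights-one t≤2 positive {v} vS' with another-kept v
      ... | u , uS' , u≢v = forced-one light (positive (S'⊆U vS')) (positive (S'⊆U uS'))
        where
        light : w' v + w' u ≤ 2
        light = ≤-trans (m≤n+m _ K) (subst (_≤ 2) (sym (pair-weight (u≢v ∘ sym) vS' uS')) t≤2)

      -- With a second kept class every kept vertex weighs as much as p: the
      -- pairs {v , z} and {p , z} have the same weight.
      weights-equal : ∀ j → j ≢ zero → ∀ {v} → v ∈ S' → w' v ≡ w' p
      weights-equal j j≢0 {v} vS' with v ≟ p
      ... | yes refl = refl
      ... | no v≢p with third-kept j j≢0 v≢p
      ...   | z , zS' , z≢v , z≢p = +-cancelʳ-≡ (w' z) _ _ (+-cancelˡ-≡ K _ _ (begin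
        K + (w' v + w' z)  ≡⟨ pair-weight (z≢v ∘ sym) vS' zS' ⟩
        t                  ≡⟨ sym (pair-weight (z≢p ∘ sym) p∈S' zS') ⟩
        K + (w' p + w' z)  ∎))
        where open ≡-Reasoning

      uniform-weight : ∀ {k} → 1 ≤ k → t ≤ 2 * suc r → (∀ v → U v → 1 ≤ w' v × w' v ≤ k) →
                       ∃ λ c → (1 ≤ c × c ≤ k) × (∀ {v} → v ∈ S' → w' v ≡ c)
      uniform-weight 1≤k t≤2r bounds with small-or-second t≤2r
      ... | inj₁ t≤2       = 1 , (s≤s z≤n , 1≤k) , weights-one t≤2 (λ {v} → proj₁ ∘ bounds v)
      ... | inj₂ (j , j≢0) = w' p , bounds p (S'⊆U p∈S') , weights-equal j j≢0

      module Extended (c : ℕ) (uniform : ∀ {v} → v ∈ S' → w' v ≡ c) where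

        w : Fin N → ℕ
        w v = if does (v ∈? S) then c else w' v

        w-inside : ∀ {v} → v ∈ S → w v ≡ c
        w-inside {v} vS with v ∈? S
        ... | yes _   = refl
        ... | no  v∉S = contradiction vS v∉S

        w-outside : ∀ {v} → v ∉ S → w v ≡ w' v
        w-outside {v} v∉S with v ∈? S
        ... | yes vS = contradiction vS v∉S
        ... | no  _  = refl

        w-bounds : ∀ {k} → 1 ≤ c × c ≤ k → (∀ v → U v → 1 ≤ w' v × w' v ≤ k) →
                   ∀ v → 1 ≤ w v × w v ≤ k
        w-bounds c-bounds bounds v with v ∈? S
        ... | yes _   = c-bounds
        ... | no  v∉S = bounds v (outside∈U v∉S)

        wsum-w : ∀ D → wsum w D ≡ wsum w' (outer D) + c * inner D
        wsum-w D = begin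
          wsum w D                            ≡⟨ wsum-split w D S ⟩
          wsum w (D ∩ S) + wsum w (outer D)   ≡⟨ cong₂ _+_ on-S off-S ⟩
          c * inner D + wsum w' (outer D)     ≡⟨ +-comm (c * inner D) _ ⟩
          wsum w' (outer D) + c * inner D     ∎
          where
          open ≡-Reasoning
          on-S : wsum w (D ∩ S) ≡ c * inner D
          on-S = wsum-const w c (D ∩ S) (w-inside ∘ p∩q⊆q D S)
          off-S : wsum w (outer D) ≡ wsum w' (outer D)
          off-S = wsum-cong w w' (outer D) (w-outside ∘ proj₂ ∘ outer⁻)

        moved-onto-kept : ∀ D → inner D ≤ 2 * suc r →
                          ∃ λ E → E ⊆ᵥ U × Similar D E × wsum w D ≡ wsum w' E
        moved-onto-kept D fits with subset-of-size S' (inner D) (≤-trans fits ∣S'∣)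
        ... | F , F⊆S' , ∣F∣ =
          replace D F , replace⊆U D F⊆S' , replace-similar D (S'⊆S ∘ F⊆S') ∣F∣ , (begin
            wsum w D                        ≡⟨ wsum-w D ⟩
            wsum w' (outer D) + c * inner D ≡⟨ cong (λ m → wsum w' (outer D) + c * m) (sym ∣F∣) ⟩
            wsum w' (outer D) + c * ∣ F ∣   ≡⟨ cong (wsum w' (outer D) +_) (sym on-F) ⟩
            wsum w' (outer D) + wsum w' F   ≡⟨ sym (wsum-replace w' D (S'⊆S ∘ F⊆S')) ⟩
            wsum w' (replace D F)           ∎)
          where
          open ≡-Reasoning
          on-F : wsum w' F ≡ c * ∣ F ∣
          on-F = wsum-const w' c F (uniform ∘ F⊆S')

        too-heavy : 1 ≤ c → t ≤ 2 * suc r → ∀ D → 2 * suc r < inner D → t < wsum w D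
        too-heavy 1≤c t≤2r D many = begin-strict
          t                               ≤⟨ t≤2r ⟩
          2 * suc r                       <⟨ many ⟩
          inner D                         ≤⟨ m≤c*m (inner D) 1≤c ⟩
          c * inner D                     ≤⟨ m≤n+m _ (wsum w' (outer D)) ⟩
          wsum w' (outer D) + c * inner D ≡⟨ sym (wsum-w D) ⟩
          wsum w D                        ∎
          where open ≤-Reasoning

        equidominating : 1 ≤ c → t ≤ 2 * suc r → ∀ D → MDS G AllV D ⇔ wsum w D ≡ t
        equidominating 1≤c t≤2r D with inner D ≤? 2 * suc r
        ... | yes fits with moved-onto-kept D fits
        ...   | E , E⊆U , sim , same-weight =
          same-target ⇔-∘ (equi E E⊆U ⇔-∘ (⇔-sym (mds-remaining E E⊆U) ⇔-∘ mds-similar⇔ sim))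
          where
          same-target : wsum w' E ≡ t ⇔ wsum w D ≡ t
          same-target = mk⇔ (trans same-weight) (trans (sym same-weight))
        equidominating 1≤c t≤2r D | no too-many =
          mk⇔ (λ mds → contradiction (≤-trans (s≤s (*-monoʳ-≤ 2 (s≤s z≤n))) many) (mds-inner≤2 mds))
              (λ eq  → contradiction (sym eq) (<⇒≢ (too-heavy 1≤c t≤2r D many)))
          where
          many : 2 * suc r < inner D
          many = ≰⇒> too-many

    restrict : ∀ {k t} → TargetEquidominating G AllV k t → TargetEquidominating G U k t
    restrict (1≤t , w , bounds , equi) =
      1≤t , w , (λ v _ → bounds v _) , λ D D⊆U → equi D (λ _ _ → _) ⇔-∘ mds-remaining D D⊆U

    extend : ∀ {k t} → 1 ≤ k → t ≤ 2 * suc r →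
             TargetEquidominating G U k t → TargetEquidominating G AllV k t
    extend {k} {t} 1≤k t≤2r (1≤t , w' , bounds , equi)
      with Weights.uniform-weight w' t equi 1≤k t≤2r bounds
    ... | c , c-bounds@(1≤c , _) , uniform =
      1≤t , w , (λ v _ → w-bounds c-bounds bounds v) , λ D _ → equidominating 1≤c t≤2r D
      where open Weights.Extended w' t equi c uniform

-- For r ≥ 1 kept classes of the bundle S and t ≤ 2r, G and G' are equally
-- target-t k-equidominating.  (The hypothesis that S has more than r classes only
-- ensures that something is deleted; the equivalence holds regardless.)
lemma5p3 : ∀ {N} (G : Graph N) (r k : ℕ) → 1 ≤ r → 1 ≤ k
    → (S : Subset N) → StableSetBundle G S
    → (cs : Vec (Subset N) (suc r)) → DistinctClassesIn G S cs
    → (kept : Vec (Subset N) r) → DistinctClassesIn G S kept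
    → ∀ t → t ≤ 2 * r
    → TargetEquidominating G AllV k t ⇔ TargetEquidominating G (Remaining G S kept) k t
lemma5p3 G (suc r) k (s≤s z≤n) 1≤k S (candidate , _) _ _ kept distinct t t≤2r =
  mk⇔ restrict (extend 1≤k t≤2r)
  where open Cocktail.Deletion (bundle-cocktail {G = G} {S = S} candidate) kept distinct
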